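{- Let $G$ be a 2-walk $(a,b)$-parabolic graph. Let $R=x_1x_2\cdots x_t$ be a path or a cycle (in the latter case $x_1=x_t$) of length at least $2$ in $G$ such that $d(x_1)\geq 3$, $d(x_t)\geq 3$ and $d(x_2)=\cdots=d(x_{t-1})=2$. Then: (i) if $d(x_1)=d(x_t)$, then $l(R)\leq 3$; moreover, if $l(R)=3$, then there is no path $Q=y_1y_2y_3$ in $G$ with $d(y_1)=d(y_3)=d(x_1)$ and $d(y_2)=2$; (ii) if $d(x_1)\neq d(x_t)$, then $l(R)\leq 2$.
   Context: Graphs are finite, simple and connected; $d(v)$ denotes the degree of $v$ in $G$ and $s(v)=\sum_{u\in N_G(v)}d(u)$ where $N_G(v)$ is the neighbourhood of $v$. A graph $G$ is 2-walk $(a,b)$-parabolic if there exist uniquely a positive integer $a$ and a non-negative integer $b$ such that $a^2-8b>0$ and $s(v)=-d(v)^2+a\,d(v)-b$ for all $v\in V(G)$. The length $l(R)$ of a path or cycle $R$ is its number of edges. -}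

module Defs where

open import Data.Nat using (ℕ; zero; suc; _+_; _*_; _≤_; _<_)
open import Data.Fin using (Fin; zero; suc; inject₁; fromℕ)
open import Data.List using (List; map; allFin)
open import Data.Nat.ListAction using (sum)
open import Data.Bool using (Bool; true; false; if_then_else_)
open import Data.Product using (Σ; ∃; _×_; _,_)
open import Relation.Binary.PropositionalEquality using (_≡_; _≢_)
open import Function.Definitions using (Injective)

record Graph (n : ℕ) : Set where
  field
    adj   : Fin n → Fin n → Bool
    sym   : ∀ u v → adj u v ≡ adj v u
    irrefl : ∀ v → adj v v ≡ false
open Graph public

module _ {n : ℕ} (G : Graph n) where

  IsWalk : (m : ℕ) → (Fin (suc m) → Fin n) → Set
  IsWalk m x = ∀ (i : Fin m) → adj G (x (inject₁ i)) (x (suc i)) ≡ true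

  Connected : Set
  Connected = ∀ (u v : Fin n) → Σ ℕ λ m → Σ (Fin (suc m) → Fin n) λ x →
                IsWalk m x × x zero ≡ u × x (fromℕ m) ≡ v

  deg : Fin n → ℕ
  deg v = sum (map (λ u → if adj G v u then 1 else 0) (allFin n))

  s : Fin n → ℕ
  s v = sum (map (λ u → if adj G v u then deg u else 0) (allFin n))

  -- s(v) = -d(v)^2 + a d(v) - b, rearranged over ℕ (exactly equivalent over ℤ)
  ParabolicEq : ℕ → ℕ → Set
  ParabolicEq a b = (0 < a) × (8 * b < a * a) ×
                    (∀ v → s v + deg v * deg v + b ≡ a * deg v)

  Parabolic : ℕ → ℕ → Set
  Parabolic a b = ParabolicEq a b ×
                  (∀ a' b' → ParabolicEq a' b' → (a' ≡ a) × (b' ≡ b))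

  IsPath : (m : ℕ) → (Fin (suc m) → Fin n) → Set
  IsPath m x = IsWalk m x × Injective _≡_ _≡_ x

  IsCycle : (m : ℕ) → (Fin (suc m) → Fin n) → Set
  IsCycle m x = (3 ≤ m) × IsWalk m x × x zero ≡ x (fromℕ m) ×
                Injective _≡_ _≡_ (λ (i : Fin m) → x (inject₁ i))

  Path3 : ℕ → Set
  Path3 k = Σ (Fin n) λ y₁ → Σ (Fin n) λ y₂ → Σ (Fin n) λ y₃ →
            adj G y₁ y₂ ≡ true × adj G y₂ y₃ ≡ true ×
            y₁ ≢ y₂ × y₂ ≢ y₃ × y₁ ≢ y₃ ×
            deg y₁ ≡ k × deg y₃ ≡ k × deg y₂ ≡ 2

module Submission where

-- In a 2-walk (a,b)-parabolic graph s(v) is a function of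
-- d(v) alone, so all vertices of degree 2 have the same s-value.  A vertex
-- v of degree 2 with neighbours u ≠ w has s(v) = d(u) + d(w); call u v w a
-- degree-2 hinge.  Hence all degree-2 hinges have the same sum of end degrees.
--
-- Write R = x₀ x₁ … x_m.  For m ≥ 3 the hinges x₀x₁x₂ and x₁x₂x₃ give
-- d(x₀) + 2 = s(x₁) = s(x₂) = 2 + d(x₃), i.e. d(x₀) = d(x₃).  If m ≥ 4 then
-- x₃ is interior and d(x₀) = 2 < 3, impossible; so m ≤ 3, and m = 3 forces
-- d(x₀) = d(x_m), which gives (ii).  A path Q = y₁y₂y₃ as in (i) is a hinge,
-- so 2·d(x₀) = d(y₁) + d(y₃) = d(x₀) + d(x₂) = d(x₀) + 2, i.e. d(x₀) = 2.

open import Defs renaming (sym to adj-sym)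
open import Data.Nat using (ℕ; zero; suc; _+_; _*_; _≤_; z≤n; s≤s)
open import Data.Nat.Properties
  using (m≤m+n; m≤n+m; ≤-refl; ≤-trans; +-comm; +-identityʳ; +-cancelˡ-≡; +-cancelʳ-≡;
         suc-injective; m≢1+n+m; _≟_)
open import Data.Fin using (Fin; zero; suc; fromℕ; toℕ; inject₁; lower₁)
open import Data.Fin.Properties
  using (toℕ-injective; toℕ-fromℕ; toℕ-inject₁; toℕ-lower₁; inject₁-lower₁)
open import Data.List using (tabulate)
open import Data.List.Properties using (map-tabulate)
open import Data.Nat.ListAction using (sum)
open import Data.Bool using (Bool; true; false; if_then_else_)
open import Data.Empty using (⊥-elim)
open import Data.Product using (_×_; _,_)
open import Data.Sum using (_⊎_; inj₁; inj₂)
open import Relation.Binary.PropositionalEquality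
  using (_≡_; _≢_; refl; sym; trans; cong; cong₂; subst; module ≡-Reasoning)
open import Relation.Nullary using (¬_; yes; no)
open import Function using (_∘_)

sumOver : ∀ {n} → (Fin n → Bool) → (Fin n → ℕ) → ℕ
sumOver b f = sum (tabulate (λ i → if b i then f i else 0))

count : ∀ {n} → (Fin n → Bool) → ℕ
count b = sumOver b (λ _ → 1)

selected≤sumOver : ∀ {n} (b : Fin n → Bool) (f : Fin n → ℕ) u →
                   b u ≡ true → f u ≤ sumOver b f
selected≤sumOver b f zero bu with b zero
... | true = m≤m+n (f zero) _
selected≤sumOver b f (suc u) bu with b zero
... | true  = ≤-trans (selected≤sumOver (b ∘ suc) (f ∘ suc) u bu) (m≤n+m _ (f zero))
... | false = selected≤sumOver (b ∘ suc) (f ∘ suc) u bu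

unselected : ∀ {n} (b : Fin n → Bool) u → count b ≡ 0 → b u ≢ true
unselected b u c≡0 bu with () ← subst (1 ≤_) c≡0 (selected≤sumOver b (λ _ → 1) u bu)

sumOver-empty : ∀ {n} (b : Fin n → Bool) (f : Fin n → ℕ) → count b ≡ 0 → sumOver b f ≡ 0
sumOver-empty {zero}  b f c≡0 = refl
sumOver-empty {suc n} b f c≡0 with b zero
... | false = sumOver-empty (b ∘ suc) (f ∘ suc) c≡0

sumOver-single : ∀ {n} (b : Fin n → Bool) (f : Fin n → ℕ) u →
                 count b ≡ 1 → b u ≡ true → sumOver b f ≡ f u
sumOver-single b f zero c≡1 bu with b zero
... | true = trans (cong (f zero +_) (sumOver-empty (b ∘ suc) (f ∘ suc) (suc-injective c≡1)))
                   (+-identityʳ (f zero))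
sumOver-single b f (suc u) c≡1 bu with b zero
... | true  = ⊥-elim (unselected (b ∘ suc) u (suc-injective c≡1) bu)
... | false = sumOver-single (b ∘ suc) (f ∘ suc) u c≡1 bu

-- A selection of size 1 has at most one element (sum the indices toℕ).
single-unique : ∀ {n} (b : Fin n → Bool) u w →
                count b ≡ 1 → b u ≡ true → b w ≡ true → u ≡ w
single-unique b u w c≡1 bu bw = toℕ-injective
  (trans (sym (sumOver-single b toℕ u c≡1 bu)) (sumOver-single b toℕ w c≡1 bw))

sumOver-pair : ∀ {n} (b : Fin n → Bool) (f : Fin n → ℕ) u w →
               count b ≡ 2 → b u ≡ true → b w ≡ true → u ≢ w →
               sumOver b f ≡ f u + f w
sumOver-pair b f zero zero c≡2 bu bw u≢w = ⊥-elim (u≢w refl)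
sumOver-pair b f zero (suc w) c≡2 bu bw u≢w with b zero
... | true = cong (f zero +_) (sumOver-single (b ∘ suc) (f ∘ suc) w (suc-injective c≡2) bw)
sumOver-pair b f (suc u) zero c≡2 bu bw u≢w with b zero
... | true = trans (cong (f zero +_) (sumOver-single (b ∘ suc) (f ∘ suc) u (suc-injective c≡2) bu))
                   (+-comm (f zero) (f (suc u)))
sumOver-pair b f (suc u) (suc w) c≡2 bu bw u≢w with b zero
... | true  = ⊥-elim (u≢w (cong suc (single-unique (b ∘ suc) u w (suc-injective c≡2) bu bw)))
... | false = sumOver-pair (b ∘ suc) (f ∘ suc) u w c≡2 bu bw (u≢w ∘ cong suc)

module _ {n : ℕ} (G : Graph n) where

  deg≡count : ∀ v → deg G v ≡ count (adj G v)
  deg≡count v = cong sum (map-tabulate (λ i → i) (λ u → if adj G v u then 1 else 0))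

  s≡sumOver : ∀ v → s G v ≡ sumOver (adj G v) (deg G)
  s≡sumOver v = cong sum (map-tabulate (λ i → i) (λ u → if adj G v u then deg G u else 0))

  -- u v w is a path through a vertex v of degree 2; u and w are then
  -- exactly the neighbours of v.
  record DegreeTwoHinge (u v w : Fin n) : Set where
    field
      left-edge  : adj G u v ≡ true
      right-edge : adj G v w ≡ true
      ends-differ : u ≢ w
      centre-deg : deg G v ≡ 2
  open DegreeTwoHinge

  s-at-hinge : ∀ {u v w} → DegreeTwoHinge u v w → s G v ≡ deg G u + deg G w
  s-at-hinge {u} {v} {w} h =
    trans (s≡sumOver v)
          (sumOver-pair (adj G v) (deg G) u w (trans (sym (deg≡count v)) (centre-deg h))
                        (trans (adj-sym G v u) (left-edge h)) (right-edge h) (ends-differ h))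

  s-determined-by-deg : ∀ {a b} → ParabolicEq G a b →
                        ∀ v v' → deg G v ≡ deg G v' → s G v ≡ s G v'
  s-determined-by-deg {a} {b} (_ , _ , s-eq) v v' dv≡dv' =
    +-cancelʳ-≡ _ _ _ (+-cancelʳ-≡ _ _ _ (begin
      s G v  + deg G v  * deg G v  + b  ≡⟨ s-eq v ⟩
      a * deg G v                       ≡⟨ cong (a *_) dv≡dv' ⟩
      a * deg G v'                      ≡⟨ sym (s-eq v') ⟩
      s G v' + deg G v' * deg G v' + b  ≡⟨ cong (λ d → s G v' + d * d + b) (sym dv≡dv') ⟩
      s G v' + deg G v  * deg G v  + b  ∎))
    where open ≡-Reasoning

  hinge-sums-agree : ∀ {a b} → ParabolicEq G a b →
                     ∀ {u v w u' v' w'} → DegreeTwoHinge u v w → DegreeTwoHinge u' v' w' →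
                     deg G u + deg G w ≡ deg G u' + deg G w'
  hinge-sums-agree pe {u} {v} {w} {u'} {v'} {w'} h h' = begin
    deg G u + deg G w    ≡⟨ sym (s-at-hinge h) ⟩
    s G v                ≡⟨ s-determined-by-deg pe v v' (trans (centre-deg h) (sym (centre-deg h'))) ⟩
    s G v'               ≡⟨ s-at-hinge h' ⟩
    deg G u' + deg G w'  ∎
    where open ≡-Reasoning

  hinge-chain-balance : ∀ {a b} → ParabolicEq G a b →
                        ∀ {x₀ x₁ x₂ x₃} → DegreeTwoHinge x₀ x₁ x₂ → DegreeTwoHinge x₁ x₂ x₃ →
                        deg G x₀ ≡ deg G x₃
  hinge-chain-balance pe {x₀} {x₁} {x₂} {x₃} h₁ h₂ = +-cancelʳ-≡ _ _ _ (begin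
    deg G x₀ + 2         ≡⟨ cong (deg G x₀ +_) (sym (centre-deg h₂)) ⟩
    deg G x₀ + deg G x₂  ≡⟨ hinge-sums-agree pe h₁ h₂ ⟩
    deg G x₁ + deg G x₃  ≡⟨ cong (_+ deg G x₃) (centre-deg h₁) ⟩
    2 + deg G x₃         ≡⟨ +-comm 2 (deg G x₃) ⟩
    deg G x₃ + 2         ∎)
    where open ≡-Reasoning

  no-balanced-hinge : ∀ {a b} → ParabolicEq G a b →
                      ∀ {k u v w} → DegreeTwoHinge u v w → deg G u ≡ k → deg G w ≡ 2 →
                      Path3 G k → k ≡ 2
  no-balanced-hinge pe {k} {u} {v} {w} h du dw (y₁ , y₂ , y₃ , e₁₂ , e₂₃ , _ , _ , y₁≢y₃ , d₁ , d₃ , d₂) =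
    +-cancelˡ-≡ k _ _ (begin
      k + k                ≡⟨ sym (cong₂ _+_ d₁ d₃) ⟩
      deg G y₁ + deg G y₃  ≡⟨ hinge-sums-agree pe hinge-y h ⟩
      deg G u + deg G w    ≡⟨ cong₂ _+_ du dw ⟩
      k + 2                ∎)
    where
    open ≡-Reasoning
    hinge-y : DegreeTwoHinge y₁ y₂ y₃
    hinge-y = record { left-edge = e₁₂ ; right-edge = e₂₃ ; ends-differ = y₁≢y₃ ; centre-deg = d₂ }

≥3⇒≢2 : ∀ {d} → 3 ≤ d → d ≢ 2
≥3⇒≢2 (s≤s (s≤s (s≤s _))) ()

module _ {n : ℕ} (G : Graph n) where

  walk-of : ∀ {m x} → IsPath G m x ⊎ IsCycle G m x → IsWalk G m x
  walk-of (inj₁ (walk , _))     = walk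
  walk-of (inj₂ (_ , walk , _)) = walk

  private
    two-steps-apart : ∀ {j} (i : Fin (suc j)) (p : Fin (suc (suc (suc j)))) →
                      toℕ p ≡ suc (suc (toℕ i)) → inject₁ (inject₁ i) ≢ p
    two-steps-apart i p p≡i+2 i≡p = m≢1+n+m (toℕ i) {1} (begin
      toℕ i                      ≡⟨ sym (toℕ-inject₁ i) ⟩
      toℕ (inject₁ i)            ≡⟨ sym (toℕ-inject₁ (inject₁ i)) ⟩
      toℕ (inject₁ (inject₁ i))  ≡⟨ cong toℕ i≡p ⟩
      toℕ p                      ≡⟨ p≡i+2 ⟩
      suc (suc (toℕ i))          ∎)
      where open ≡-Reasoning

  -- On a path or a cycle, vertices two steps apart are distinct.  (On a
  -- cycle this uses its length being at least 3.)
  two-apart-distinct : ∀ {j} (x : Fin (suc (suc (suc j))) → Fin n) →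
                       IsPath G (suc (suc j)) x ⊎ IsCycle G (suc (suc j)) x →
                       ∀ (i : Fin (suc j)) → x (inject₁ (inject₁ i)) ≢ x (suc (suc i))
  two-apart-distinct x (inj₁ (_ , injective)) i xi≡xi+2 =
    two-steps-apart i (suc (suc i)) refl (injective xi≡xi+2)
  two-apart-distinct {j} x (inj₂ (3≤m , _ , closed , injective)) i xi≡xi+2
    with suc (suc j) ≟ toℕ (suc (suc i))
  -- if i+2 < m, both positions lie where the cycle is injective
  ... | no m≢i+2 = two-steps-apart i (inject₁ (lower₁ (suc (suc i)) m≢i+2))
                     (trans (toℕ-inject₁ _) (toℕ-lower₁ (suc (suc i)) m≢i+2))
                     (cong inject₁ (injective (trans xi≡xi+2 (cong x (sym (inject₁-lower₁ _ m≢i+2))))))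
  ... | yes m≡i+2 = ≥3⇒≢2 3≤m (trans m≡i+2 (cong (λ k → suc (suc k)) i≡0))
    where
    -- position i+2 is the closing vertex x_m = x₀, so i must be 0
    i+2≡last : suc (suc i) ≡ fromℕ (suc (suc j))
    i+2≡last = toℕ-injective (trans (sym m≡i+2) (sym (toℕ-fromℕ _)))
    i≡0 : toℕ i ≡ 0
    i≡0 = trans (sym (toℕ-inject₁ i))
                (cong toℕ (injective (trans xi≡xi+2 (trans (cong x i+2≡last) (sym closed)))))

  initial-hinges : ∀ {k} (x : Fin (suc (suc (suc (suc k)))) → Fin n) →
                   let m = suc (suc (suc k)) in
                   IsPath G m x ⊎ IsCycle G m x →
                   (∀ i → i ≢ zero → i ≢ fromℕ m → deg G (x i) ≡ 2) →
                   DegreeTwoHinge G (x zero) (x (suc zero)) (x (suc (suc zero))) ×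
                   DegreeTwoHinge G (x (suc zero)) (x (suc (suc zero))) (x (suc (suc (suc zero))))
  initial-hinges x R interior =
    record { left-edge   = walk zero
           ; right-edge  = walk (suc zero)
           ; ends-differ = two-apart-distinct x R zero
           ; centre-deg  = interior (suc zero) (λ ()) (λ ()) } ,
    record { left-edge   = walk (suc zero)
           ; right-edge  = walk (suc (suc zero))
           ; ends-differ = two-apart-distinct x R (suc zero)
           ; centre-deg  = interior (suc (suc zero)) (λ ()) (λ ()) }
    where
    walk : IsWalk G _ x
    walk = walk-of R

lemma5 : ∀ {n} (G : Graph n) → Connected G → ∀ a b → Parabolic G a b →
         ∀ (m : ℕ) (x : Fin (suc m) → Fin n) →
         (IsPath G m x ⊎ IsCycle G m x) → 2 ≤ m →
         3 ≤ deg G (x zero) → 3 ≤ deg G (x (fromℕ m)) →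
         (∀ (i : Fin (suc m)) → i ≢ zero → i ≢ fromℕ m → deg G (x i) ≡ 2) →
         ((deg G (x zero) ≡ deg G (x (fromℕ m)) →
            (m ≤ 3) × (m ≡ 3 → ¬ Path3 G (deg G (x zero)))) ×
          (deg G (x zero) ≢ deg G (x (fromℕ m)) → m ≤ 2))
lemma5 G _ a b _        zero                      x R ()
lemma5 G _ a b _        (suc zero)                x R (s≤s ())
lemma5 G _ a b _        2                         x R _ _ _ _ =
  (λ _ → s≤s (s≤s z≤n) , λ ()) , λ _ → ≤-refl
-- length 3: the end degrees agree, and a path Q would force d(x₀) = 2
lemma5 G _ a b (pe , _) 3                         x R _ x₀≥3 _ interior
  with initial-hinges G x R interior
... | h₁ , h₂ =
      (λ _ → ≤-refl , λ _ Q → ≥3⇒≢2 x₀≥3 (no-balanced-hinge G pe h₁ refl x₂-deg Q))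
    , λ x₀≢x₃ → ⊥-elim (x₀≢x₃ (hinge-chain-balance G pe h₁ h₂))
  where x₂-deg = DegreeTwoHinge.centre-deg h₂
-- length ≥ 4: x₃ is interior, so d(x₀) = d(x₃) = 2
lemma5 G _ a b (pe , _) (suc (suc (suc (suc _)))) x R _ x₀≥3 _ interior
  with initial-hinges G x R interior
... | h₁ , h₂ =
  ⊥-elim (≥3⇒≢2 x₀≥3 (trans (hinge-chain-balance G pe h₁ h₂) (interior _ (λ ()) (λ ()))))
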